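{- The (generalized) deque machine $\mathcal D_1$ defined below is constant-delay and Hamiltonian for word lengths $\ell\ge3$: for every $\ell\ge3$ its run from $(q_{\mathrm i},0^\ell)$ halts and produces every word of $\{0,1\}^\ell$ exactly once, and there is a constant $B$ independent of $\ell$ bounding the number of steps before the first output, between consecutive outputs and after the last output. $\mathcal D_1$ has states $\{\downarrow,\uparrow\}\times\{\mathsf{Even},\mathsf{Odd}\}\times\{1,2,3,4\}\cup\{q_{\mathrm i},q_{\mathrm h}\}$, initial state $q_{\mathrm i}$, halting state $q_{\mathrm h}$, and output states $\{q_{\mathrm i}\}\cup\{(\downarrow,\mathsf{Even},s),(\uparrow,\mathsf{Odd},s): s\in\{1,2,3,4\}\}$. For $p\in\{\mathsf{Even},\mathsf{Odd}\}$ let $[p]$ be the bit $0$ if $p=\mathsf{Even}$ and $1$ if $p=\mathsf{Odd}$, and let $\overline{\mathsf{Even}}=\mathsf{Odd}$, $\overline{\mathsf{Odd}}=\mathsf{Even}$. Transitions (for all $p$ and $s$): (1) in $q_{\mathrm i}$, if the first bit is $0$ and the last bit is $0$: replace the first bit by $1$, go to $(\uparrow,\mathsf{Even},1)$; (2) in $(\downarrow,p,s)$, if the first bit is $0$ and the last bit is $[p]$: delete the first and the last symbol, then append $0$ and then $[\bar p]$ on the right, go to $(\downarrow,\bar p,s)$; (3) in $(\downarrow,p,s)$, if the first two bits are $10$ and the last bit is $[p]$: leave the word unchanged and go to $(\uparrow,p,1)$ if $s=1$, to $(\uparrow,p,3)$ if $s=2$, to $(\uparrow,p,3)$ if $s=3$,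 and to $q_{\mathrm h}$ if $s=4$; (4) in $(\downarrow,p,s)$, if the first two bits are $11$ and the last bit is $[p]$: leave the word unchanged and go to $(\uparrow,p,2)$ if $s=1$, to $(\uparrow,p,2)$ if $s=2$, to $(\uparrow,p,4)$ if $s=3$, and to $(\uparrow,p,4)$ if $s=4$; (5) in $(\uparrow,p,s)$, if the last two bits are $1[p]$: delete the last two symbols, prepend $0$ on the left and append $[\bar p]$ on the right, go to $(\uparrow,\bar p,s)$; (6) in $(\uparrow,p,s)$, if the last two bits are $0[p]$: replace the second-to-last bit by $1$, go to $(\downarrow,p,s)$. No other transitions are defined (a run reaching an undefined case does not halt).
   Context: A generalized deque machine has a finite set of states (initial state $q_{\mathrm i}$, halting state $q_{\mathrm h}$, output states) and stores a binary word of fixed length $\ell$; at each step, based on the state and on the two leftmost and two rightmost symbols of the word, it performs a constant number of pushes and pops at the two endpoints (keeping the length $\ell$) and changes state; each such transition counts as one step (it can be simulated by a constant number of steps of a deque machine that reads only the first and last bits and does one pop and one push per step). The run for length $\ell$ starts at $(q_{\mathrm i},0^\ell)$ and stops on reaching $q_{\mathrm h}$; whenever the state is an output state, the current word is produced in unit time. -}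

module Defs where

open import Data.Bool using (Bool; true; false; _∧_; if_then_else_)
open import Data.Nat using (ℕ; zero; suc; _≤_; _+_)
open import Data.List using (List; []; _∷_; _++_; reverse; drop; replicate; filter; length; map)
open import Data.List.Properties using (≡-dec)
open import Data.Maybe using (Maybe; just; nothing; _>>=_)
open import Data.Product using (_×_; _,_; proj₁; proj₂)
open import Relation.Binary.PropositionalEquality using (_≡_)
import Data.Bool as B

-- Words are lists of bits (false = 0, true = 1); the first element is the leftmost symbol.
Word : Set
Word = List Bool

data Dir : Set where
  down up : Dir

data Par : Set where
  even odd : Par

data Sub : Set where
  s1 s2 s3 s4 : Sub

data State : Set where
  qi qh : State
  st : Dir → Par → Sub → State

bit : Par → Bool
bit even = false
bit odd  = true

flipP : Par → Par
flipP even = odd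
flipP odd  = even

isOutput : State → Bool
isOutput qi             = true
isOutput qh             = false
isOutput (st down even _) = true
isOutput (st down odd  _) = false
isOutput (st up   even _) = false
isOutput (st up   odd  _) = true

first : Word → Maybe Bool
first []      = nothing
first (x ∷ _) = just x

second : Word → Maybe Bool
second (_ ∷ y ∷ _) = just y
second _           = nothing

lastB : Word → Maybe Bool
lastB w = first (reverse w)

secondLast : Word → Maybe Bool
secondLast w = second (reverse w)

is : Maybe Bool → Bool → Bool
is nothing      _     = false
is (just true)  true  = true
is (just false) false = true
is (just _)     _     = false

popL : Word → Word
popL w = drop 1 w

popR : Word → Word
popR w = reverse (drop 1 (reverse w))

setFirst : Bool → Word → Word
setFirst b []      = []
setFirst b (_ ∷ w) = b ∷ w

setSecond : Bool → Word → Word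
setSecond b (x ∷ _ ∷ w) = x ∷ b ∷ w
setSecond b w           = w

setSecondLast : Bool → Word → Word
setSecondLast b w = reverse (setSecond b (reverse w))

rule3 : Par → Sub → State
rule3 p s1 = st up p s1
rule3 p s2 = st up p s3
rule3 p s3 = st up p s3
rule3 p s4 = qh

rule4 : Par → Sub → State
rule4 p s1 = st up p s2
rule4 p s2 = st up p s2
rule4 p s3 = st up p s4
rule4 p s4 = st up p s4

Config : Set
Config = State × Word

-- one (generalized) step of D₁; nothing = no transition defined
step : Config → Maybe Config
step (qi , w) =
  if is (first w) false ∧ is (lastB w) false
  then just (st up even s1 , setFirst true w)
  else nothing
step (qh , w) = nothing
step (st down p s , w) =
  if is (first w) false ∧ is (lastB w) (bit p)
  then just (st down (flipP p) s , popR (popL w) ++ (false ∷ bit (flipP p) ∷ []))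
  else if is (first w) true ∧ is (second w) false ∧ is (lastB w) (bit p)
  then just (rule3 p s , w)
  else if is (first w) true ∧ is (second w) true ∧ is (lastB w) (bit p)
  then just (rule4 p s , w)
  else nothing
step (st up p s , w) =
  if is (secondLast w) true ∧ is (lastB w) (bit p)
  then just (st up (flipP p) s , (false ∷ popR (popR w)) ++ (bit (flipP p) ∷ []))
  else if is (secondLast w) false ∧ is (lastB w) (bit p)
  then just (st down p s , setSecondLast true w)
  else nothing

run : ℕ → ℕ → Maybe Config
run ℓ zero    = just (qi , replicate ℓ false)
run ℓ (suc t) = run ℓ t >>= step

-- outputs produced at times 0,…,t-1: (time, word) for each time the state is an output state
outputAt : ℕ → ℕ → List (ℕ × Word)
outputAt ℓ t with run ℓ t
... | nothing      = []
... | just (q , w) = if isOutput q then (t , w) ∷ [] else []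

outputs : ℕ → ℕ → List (ℕ × Word)
outputs ℓ zero    = []
outputs ℓ (suc t) = outputs ℓ t ++ outputAt ℓ t

occurrences : Word → List Word → ℕ
occurrences u ws = length (filter (λ v → ≡-dec B._≟_ u v) ws)

-- delay bound: given the previous event time `prev` (initially 0 = start of run),
-- the list of output times and the halting time n, every gap is at most B:
-- before the first output, between consecutive outputs, and after the last one.
Delay : ℕ → ℕ → List ℕ → ℕ → Set
Delay B prev []       n = n ≤ prev + B
Delay B prev (t ∷ ts) n = (t ≤ prev + B) × Delay B t ts n

{-# OPTIONS --safe #-}
module Submission where

-- The last letter of the word always equals the parity bit [p], and every transition between
-- working states changes exactly one of the direction and the parity, so output and non-output
-- states alternate: the outputs are the configurations at even times, and the delay is 2.  Replacing the parity bit by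
-- the direction bit gives a candidate output that does not depend on the parity.  From the body
-- 10ⁿ⁺¹ a phase counts through the last n + 1 letters: each increment 1u01ᵏ ↦ 1u10ᵏ rotates the
-- ones out with ↑-steps and the zeros back in with ↓-steps, and the overflow turns 1ⁿ⁺² back into
-- 10ⁿ⁺¹.  The ↑-steps visit the rotations 0ⁱ1u01ʲ and 0ⁱ1ʲ, i.e. every body once, and the ↓-steps
-- visit every nonzero body once.  The run performs the phase with both parities, starting at
-- states of opposite outputness, so the two copies output complementary halves of its
-- candidates; together with the initial output 0ℓ this is every word exactly once.

open import Defs
open import Data.Bool using (Bool; true; false; not; _∧_; if_then_else_)
import Data.Bool as Bool
open import Data.Nat using (ℕ; zero; suc; _+_; _≤_; z≤n; s≤s)
open import Data.Nat.Properties using (+-suc; +-identityʳ; +-comm; ≤-refl; ≤-trans; n≤1+n)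
open import Data.List using (List; []; _∷_; _++_; _∷ʳ_; [_]; reverse; drop; replicate; map; length; filter)
open import Data.List.Properties
  using ( ++-assoc; ++-identityʳ; ∷ʳ-++; reverse-++; reverse-involutive; map-++; map-∘; map-cong; length-++
        ; ≡-dec; ∷-injectiveˡ; ∷-injectiveʳ; filter-++; filter-accept; filter-reject)
open import Data.List.Relation.Unary.All using (All; []; _∷_)
import Data.List.Relation.Unary.All as All
import Data.List.Relation.Unary.All.Properties as All
open import Relation.Nullary using (Dec; yes; no)
open import Data.Maybe using (just; _>>=_)
open import Data.Product using (_×_; _,_; proj₁; proj₂; ∃-syntax)
open import Data.List.Relation.Binary.Permutation.Propositional
  using (_↭_; ↭-refl; ↭-sym; ↭-trans; ↭-reflexive; prep; module PermutationReasoning)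
open import Data.List.Relation.Binary.Permutation.Propositional.Properties
  using (shift; ++⁺; ++⁺ˡ; ++⁺ʳ; ++-comm; map⁺; ++-commutativeMonoid; All-resp-↭; filter-↭; ↭-length)
open import Algebra.Solver.CommutativeMonoid (++-commutativeMonoid {A = Word}) using (solve; _⊕_; _⊜_)
open import Relation.Binary.PropositionalEquality
  using (_≡_; _≢_; refl; sym; trans; cong; cong₂; subst; module ≡-Reasoning)
open import Function using (_∘′_; case_of_)
open import Data.Empty using (⊥-elim)

variable
  A : Set
  d : Dir
  p : Par
  s s′ : Sub
  c c′ c″ e : Config
  x : Word
  tr tr′ : List Word

zeros ones : ℕ → Word
zeros k = replicate k false
ones k = replicate k true

replicate-∷-comm : ∀ k (a : A) ys → replicate k a ++ a ∷ ys ≡ a ∷ replicate k a ++ ys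
replicate-∷-comm zero    a ys = refl
replicate-∷-comm (suc k) a ys = cong (a ∷_) (replicate-∷-comm k a ys)

replicate-suc : ∀ k (a : A) → replicate (suc k) a ≡ replicate k a ∷ʳ a
replicate-suc k a = sym (trans (replicate-∷-comm k a []) (cong (a ∷_) (++-identityʳ _)))

++-replicate-suc : ∀ (xs : List A) k a → xs ++ replicate (suc k) a ≡ (xs ++ replicate k a) ∷ʳ a
++-replicate-suc xs k a = trans (cong (xs ++_) (replicate-suc k a)) (sym (++-assoc xs _ _))

reverse-∷ʳ : ∀ (xs : List A) a → reverse (xs ∷ʳ a) ≡ a ∷ reverse xs
reverse-∷ʳ xs a = reverse-++ xs [ a ]

lastB-∷ʳ : ∀ w b → lastB (w ∷ʳ b) ≡ just b
lastB-∷ʳ w b = cong first (reverse-∷ʳ w b)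

secondLast-∷ʳ : ∀ w a b → secondLast (w ∷ʳ a ∷ʳ b) ≡ just a
secondLast-∷ʳ w a b = cong second (trans (reverse-∷ʳ (w ∷ʳ a) b) (cong (b ∷_) (reverse-∷ʳ w a)))

popR-∷ʳ : ∀ w b → popR (w ∷ʳ b) ≡ w
popR-∷ʳ w b = trans (cong (λ v → reverse (drop 1 v)) (reverse-∷ʳ w b)) (reverse-involutive w)

setSecondLast-∷ʳ : ∀ w a b z → setSecondLast z (w ∷ʳ a ∷ʳ b) ≡ w ∷ʳ z ∷ʳ b
setSecondLast-∷ʳ w a b z = begin
  reverse (setSecond z (reverse (w ∷ʳ a ∷ʳ b)))
    ≡⟨ cong (reverse ∘′ setSecond z) (trans (reverse-∷ʳ (w ∷ʳ a) b) (cong (b ∷_) (reverse-∷ʳ w a))) ⟩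
  reverse (b ∷ z ∷ reverse w)
    ≡⟨ reverse-++ (b ∷ z ∷ []) (reverse w) ⟩
  reverse (reverse w) ++ z ∷ b ∷ []
    ≡⟨ cong (_++ z ∷ b ∷ []) (reverse-involutive w) ⟩
  w ++ z ∷ b ∷ []
    ≡⟨ sym (∷ʳ-++ w z [ b ]) ⟩
  w ∷ʳ z ∷ʳ b ∎
  where open ≡-Reasoning

-- Transitions of D₁

conf : Dir → Par → Sub → Word → Config
conf d p s v = st d p s , v ∷ʳ bit p

dirBit : Dir → Bool
dirBit down = false
dirBit up   = true

turn : Bool → Par → Sub → State
turn false = rule3
turn true  = rule4

is-bit : ∀ p → is (just (bit p)) (bit p) ≡ true
is-bit even = refl
is-bit odd  = refl

step-init : ∀ v → step (qi , false ∷ v ∷ʳ false) ≡ just (conf up even s1 (true ∷ v))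
step-init v rewrite lastB-∷ʳ (false ∷ v) false = refl

step-shiftDown : ∀ p s v → step (conf down p s (false ∷ v)) ≡ just (conf down (flipP p) s (v ∷ʳ false))
step-shiftDown p s v rewrite lastB-∷ʳ (false ∷ v) (bit p) | is-bit p | popR-∷ʳ v (bit p) =
  cong (λ w → just (st down (flipP p) s , w)) (sym (∷ʳ-++ v false _))

step-turnDown : ∀ p s b v → step (conf down p s (true ∷ b ∷ v)) ≡ just (turn b p s , (true ∷ b ∷ v) ∷ʳ bit p)
step-turnDown p s false v rewrite lastB-∷ʳ (true ∷ false ∷ v) (bit p) | is-bit p = refl
step-turnDown p s true  v rewrite lastB-∷ʳ (true ∷ true ∷ v) (bit p) | is-bit p = refl

step-shiftUp : ∀ p s v → step (conf up p s (v ∷ʳ true)) ≡ just (conf up (flipP p) s (false ∷ v))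
step-shiftUp p s v
  rewrite secondLast-∷ʳ v true (bit p) | lastB-∷ʳ (v ∷ʳ true) (bit p) | is-bit p
        | popR-∷ʳ (v ∷ʳ true) (bit p) | popR-∷ʳ v true = refl

step-turnUp : ∀ p s v → step (conf up p s (v ∷ʳ false)) ≡ just (conf down p s (v ∷ʳ true))
step-turnUp p s v
  rewrite secondLast-∷ʳ v false (bit p) | lastB-∷ʳ (v ∷ʳ false) (bit p) | is-bit p
        | setSecondLast-∷ʳ v false (bit p) true = refl

-- Runs and their outputs

-- The candidate of a configuration is the word it outputs if its state is an output state.
-- In a working configuration the parity bit is replaced by the direction bit: output states
-- are exactly those whose parity bit equals the direction bit, so candidates, and hence the
-- traces below, do not depend on the parity.
data Candidate : Config → Word → Set where
  initial : ∀ {w} → Candidate (qi , w) w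
  working : ∀ {d p s v} → Candidate (conf d p s v) (v ∷ʳ dirBit d)

data Run : Config → List Word → Config → Set where
  stop : Run c [] c
  next : Candidate c x → step c ≡ just c′ → Run c′ tr e → Run c (x ∷ tr) e

infixr 5 _◅◅_
_◅◅_ : Run c tr c′ → Run c′ tr′ e → Run c (tr ++ tr′) e
stop          ◅◅ r′ = r′
next cand s r ◅◅ r′ = next cand s (r ◅◅ r′)

cast : c ≡ c′ → tr ≡ tr′ → e ≡ c″ → Run c tr e → Run c′ tr′ c″
cast refl refl refl r = r

move : ∀ v → step (conf d p s v) ≡ just c → Run c tr e → Run (conf d p s v) (v ∷ʳ dirBit d ∷ tr) e
move v = next working

moveVia : ∀ v {v′} → v ≡ v′ → step (conf d p s v′) ≡ just c → c ≡ c′ → Run c′ tr e →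
          Run (conf d p s v) (v ∷ʳ dirBit d ∷ tr) e
moveVia v refl s refl r = move v s r

emits : Config → Bool
emits (q , _) = isOutput q

flipP-alternates : ∀ d p s → isOutput (st d (flipP p) s) ≡ not (isOutput (st d p s))
flipP-alternates down even s = refl
flipP-alternates down odd  s = refl
flipP-alternates up   even s = refl
flipP-alternates up   odd  s = refl

up-after-down : ∀ p s s′ → isOutput (st up p s′) ≡ not (isOutput (st down p s))
up-after-down even s s′ = refl
up-after-down odd  s s′ = refl

down-after-up : ∀ p s → isOutput (st down p s) ≡ not (isOutput (st up p s))
down-after-up even s = refl
down-after-up odd  s = refl

turn-alternates : ∀ b p s → turn b p s ≢ qh → isOutput (turn b p s) ≡ not (isOutput (st down p s))
turn-alternates false p s1 _ = up-after-down p s1 _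
turn-alternates false p s2 _ = up-after-down p s2 _
turn-alternates false p s3 _ = up-after-down p s3 _
turn-alternates false p s4 h = ⊥-elim (h refl)
turn-alternates true  p s1 _ = up-after-down p s1 _
turn-alternates true  p s2 _ = up-after-down p s2 _
turn-alternates true  p s3 _ = up-after-down p s3 _
turn-alternates true  p s4 _ = up-after-down p s4 _

step-alternates : ∀ q w {q′ w′} → step (q , w) ≡ just (q′ , w′) → q′ ≢ qh →
                  isOutput q′ ≡ not (isOutput q)
step-alternates qi w eq h with is (first w) false ∧ is (lastB w) false
... | true  = case eq of λ where refl → refl
... | false = case eq of λ ()
step-alternates qh w () h
step-alternates (st down p s) w eq h
  with is (first w) false ∧ is (lastB w) (bit p)
     | is (first w) true ∧ is (second w) false ∧ is (lastB w) (bit p)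
     | is (first w) true ∧ is (second w) true ∧ is (lastB w) (bit p)
... | true  | _     | _     = case eq of λ where refl → flipP-alternates down p s
... | false | true  | _     = case eq of λ where refl → turn-alternates false p s h
... | false | false | true  = case eq of λ where refl → turn-alternates true p s h
... | false | false | false = case eq of λ ()
step-alternates (st up p s) w eq h
  with is (secondLast w) true ∧ is (lastB w) (bit p) | is (secondLast w) false ∧ is (lastB w) (bit p)
... | true  | _     = case eq of λ where refl → flipP-alternates up p s
... | false | true  = case eq of λ where refl → down-after-up p s
... | false | false = case eq of λ ()

emits-next : step c ≡ just c′ → step c′ ≡ just c″ → emits c′ ≡ not (emits c)
emits-next {q , w} {qh , _}       _ ()
emits-next {q , w} {qi , _}       s _ = step-alternates q w s λ ()
emits-next {q , w} {st _ _ _ , _} s _ = step-alternates q w s λ ()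

keepIf : Bool → A → List A
keepIf b a = if b then a ∷ [] else []

everyOther : Bool → List A → List A
everyOther b []       = []
everyOther b (a ∷ as) = keepIf b a ++ everyOther (not b) as

alternation : step c ≡ just c′ → Run c′ tr e → (as : List A) → length as ≡ length tr →
              everyOther (emits c′) as ≡ everyOther (not (emits c)) as
alternation s stop          []  refl = refl
alternation s (next _ s′ _) as _    = cong (λ b → everyOther b as) (emits-next s s′)

everyOther-◅◅ : Run c tr c′ → Run c′ tr′ e →
                everyOther (emits c) (tr ++ tr′) ≡ everyOther (emits c) tr ++ everyOther (emits c′) tr′
everyOther-◅◅ stop _ = refl
everyOther-◅◅ {c = c} {c′ = c′} {tr′ = tr′} (next {x = x} {c′ = c₁} {tr = tr} _ s r) r′ = begin
  K ++ everyOther (not b) (tr ++ tr′)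
    ≡⟨ cong (K ++_) (sym (alternation s (r ◅◅ r′) (tr ++ tr′) refl)) ⟩
  K ++ everyOther (emits c₁) (tr ++ tr′)
    ≡⟨ cong (K ++_) (everyOther-◅◅ r r′) ⟩
  K ++ everyOther (emits c₁) tr ++ everyOther (emits c′) tr′
    ≡⟨ cong (λ as → K ++ as ++ everyOther (emits c′) tr′) (alternation s r tr refl) ⟩
  K ++ everyOther (not b) tr ++ everyOther (emits c′) tr′
    ≡⟨ sym (++-assoc K _ _) ⟩
  (K ++ everyOther (not b) tr) ++ everyOther (emits c′) tr′ ∎
  where
  open ≡-Reasoning
  b : Bool
  b = emits c
  K : List Word
  K = keepIf b x

everyOther-complement : ∀ b (as : List A) → everyOther b as ++ everyOther (not b) as ↭ as
everyOther-complement b     []       = ↭-refl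
everyOther-complement true  (a ∷ as) = prep a (everyOther-complement false as)
everyOther-complement false (a ∷ as) =
  ↭-trans (shift a (everyOther true as) _) (prep a (everyOther-complement true as))

timed : ℕ → List A → List (ℕ × A)
timed t []       = []
timed t (a ∷ as) = (t , a) ∷ timed (suc t) as

length-timed : ∀ t (as : List A) → length (timed t as) ≡ length as
length-timed t []       = refl
length-timed t (a ∷ as) = cong suc (length-timed (suc t) as)

map-proj₂-everyOther-timed : ∀ b t (as : List A) → map proj₂ (everyOther b (timed t as)) ≡ everyOther b as
map-proj₂-everyOther-timed b     t []       = refl
map-proj₂-everyOther-timed true  t (a ∷ as) = cong (a ∷_) (map-proj₂-everyOther-timed false (suc t) as)
map-proj₂-everyOther-timed false t (a ∷ as) = map-proj₂-everyOther-timed true (suc t) as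

emitted : ℕ → Config → List (ℕ × Word)
emitted t (q , w) = keepIf (isOutput q) (t , w)

outputAt-run : ∀ {ℓ t} → run ℓ t ≡ just c → outputAt ℓ t ≡ emitted t c
outputAt-run eq rewrite eq = refl

candidate-emitted : Candidate c x → ∀ t → emitted t c ≡ keepIf (emits c) (t , x)
candidate-emitted initial                t = refl
candidate-emitted (working {down} {even}) t = refl
candidate-emitted (working {down} {odd})  t = refl
candidate-emitted (working {up}   {even}) t = refl
candidate-emitted (working {up}   {odd})  t = refl

Run-sound : ∀ {ℓ t} → run ℓ t ≡ just c → Run c tr e →
          run ℓ (t + length tr) ≡ just e
          × outputs ℓ (t + length tr) ≡ outputs ℓ t ++ everyOther (emits c) (timed t tr)
Run-sound {t = t} eq stop rewrite +-identityʳ t = eq , sym (++-identityʳ _)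
Run-sound {c = c} {ℓ = ℓ} {t = t} eq (next {x = x} {c′ = c′} {tr = tr} cand s r)
  with Run-sound {t = suc t} (trans (cong (_>>= step) eq) s) r
... | halts , outs rewrite +-suc t (length tr) = halts , (begin
  outputs ℓ (suc t + length tr)
    ≡⟨ outs ⟩
  (outputs ℓ t ++ outputAt ℓ t) ++ everyOther (emits c′) (timed (suc t) tr)
    ≡⟨ cong₂ (λ os rest → (outputs ℓ t ++ os) ++ rest)
             (trans (outputAt-run eq) (candidate-emitted cand t))
             (alternation {c = c} s r (timed (suc t) tr) (length-timed (suc t) tr)) ⟩
  (outputs ℓ t ++ keepIf (emits c) (t , x)) ++ everyOther (not (emits c)) (timed (suc t) tr)
    ≡⟨ ++-assoc (outputs ℓ t) _ _ ⟩
  outputs ℓ t ++ everyOther (emits c) (timed t (x ∷ tr)) ∎)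
  where open ≡-Reasoning

everyOther-delay : ∀ b t prev (as : List A) → (if b then t else suc t) ≤ prev + 2 →
                   Delay 2 prev (map proj₁ (everyOther b (timed t as))) (t + length as)
everyOther-delay true  t prev []       h = subst (_≤ prev + 2) (sym (+-identityʳ t)) h
everyOther-delay false t prev []       h = subst (_≤ prev + 2) (sym (+-identityʳ t)) (≤-trans (n≤1+n t) h)
everyOther-delay true  t prev (a ∷ as) h =
  h , subst (Delay 2 t _) (sym (+-suc t (length as)))
            (everyOther-delay false (suc t) t as (subst (suc (suc t) ≤_) (+-comm 2 t) ≤-refl))
everyOther-delay false t prev (a ∷ as) h =
  subst (Delay 2 prev _) (sym (+-suc t (length as))) (everyOther-delay true (suc t) prev as h)

-- The run of D₁

flipN : ℕ → Par → Par
flipN zero    p = p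
flipN (suc j) p = flipN j (flipP p)

flipN-flipP : ∀ j p → flipN j (flipP p) ≡ flipP (flipN j p)
flipN-flipP zero    p = refl
flipN-flipP (suc j) p = flipN-flipP j (flipP p)

flipP-involutive : ∀ p → flipP (flipP p) ≡ p
flipP-involutive even = refl
flipP-involutive odd  = refl

flipN-involutive : ∀ j p → flipN j (flipN j p) ≡ p
flipN-involutive zero    p = refl
flipN-involutive (suc j) p = begin
  flipN j (flipP (flipN j (flipP p)))  ≡⟨ cong (flipN j ∘′ flipP) (flipN-flipP j p) ⟩
  flipN j (flipP (flipP (flipN j p)))  ≡⟨ cong (flipN j) (flipP-involutive (flipN j p)) ⟩
  flipN j (flipN j p)                  ≡⟨ flipN-involutive j p ⟩
  p                                    ∎
  where open ≡-Reasoning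

upShifts : Word → ℕ → List Word
upShifts X zero    = []
upShifts X (suc j) = (X ++ ones (suc j)) ∷ upShifts (false ∷ X) j

downShifts : Word → ℕ → List Word
downShifts Y zero    = []
downShifts Y (suc j) = (zeros (suc j) ++ Y) ∷ downShifts (Y ∷ʳ false) j

shiftUp : ∀ j X → Run (conf up p s (X ++ ones j)) (map (_∷ʳ true) (upShifts X j))
                      (conf up (flipN j p) s (zeros j ++ X))
shiftUp zero    X = cast (cong (conf up _ _) (sym (++-identityʳ X))) refl refl stop
shiftUp {p = p} {s = s} (suc j) X =
  moveVia (X ++ ones (suc j)) (++-replicate-suc X j true) (step-shiftUp p s (X ++ ones j)) refl
    (cast refl refl (cong (conf up _ s) (replicate-∷-comm j false X)) (shiftUp j (false ∷ X)))

shiftDown : ∀ j Y → Run (conf down p s (zeros j ++ Y)) (map (_∷ʳ false) (downShifts Y j))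
                        (conf down (flipN j p) s (Y ++ zeros j))
shiftDown zero    Y = cast refl refl (cong (conf down _ _) (sym (++-identityʳ Y))) stop
shiftDown {p = p} {s = s} (suc j) Y =
  moveVia (zeros (suc j) ++ Y) refl (step-shiftDown p s (zeros j ++ Y))
          (cong (conf down (flipP p) s) (++-assoc (zeros j) Y [ false ]))
    (cast refl refl (cong (conf down _ s) (∷ʳ-++ Y false (zeros j))) (shiftDown j (Y ∷ʳ false)))

upSweep downSweep : Word → ℕ → List Word
upSweep   X j = upShifts X j ∷ʳ (zeros j ++ X)
downSweep Y j = downShifts Y j ∷ʳ (Y ++ zeros j)

incrementTrace : Word → ℕ → List Word
incrementTrace u k = map (_∷ʳ true) (upSweep (true ∷ u ∷ʳ false) k)
                  ++ map (_∷ʳ false) (downSweep (true ∷ u ∷ʳ true) k)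

increment : ∀ u k →
  step (conf down p s (true ∷ u ∷ʳ true ++ zeros k)) ≡ just (conf up p s′ (true ∷ u ∷ʳ true ++ zeros k)) →
  Run (conf up p s (true ∷ u ∷ʳ false ++ ones k)) (incrementTrace u k)
      (conf up p s′ (true ∷ u ∷ʳ true ++ zeros k))
increment {p = p} {s = s} u k turnStep =
  cast refl trace-≡ refl
    (shiftUp k X ◅◅
     moveVia (zeros k ++ X) (sym (++-assoc (zeros k) (true ∷ u) [ false ]))
             (step-turnUp q s (zeros k ++ true ∷ u))
             (cong (conf down q s) (++-assoc (zeros k) (true ∷ u) [ true ]))
     (cast refl refl (cong (λ p′ → conf down p′ s (Y ++ zeros k)) (flipN-involutive k p)) (shiftDown k Y) ◅◅
      move (Y ++ zeros k) turnStep stop))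
  where
  X Y : Word
  X = true ∷ u ∷ʳ false
  Y = true ∷ u ∷ʳ true
  q : Par
  q = flipN k p
  U D : List Word
  U = map (_∷ʳ true) (upShifts X k)
  D = map (_∷ʳ false) (downShifts Y k)
  trace-≡ : U ++ (zeros k ++ X) ∷ʳ true ∷ D ++ [ (Y ++ zeros k) ∷ʳ false ] ≡ incrementTrace u k
  trace-≡ = sym (begin
    incrementTrace u k
      ≡⟨ cong₂ _++_ (map-++ _ (upShifts X k) _) (map-++ _ (downShifts Y k) _) ⟩
    (U ++ [ (zeros k ++ X) ∷ʳ true ]) ++ D ++ [ (Y ++ zeros k) ∷ʳ false ]
      ≡⟨ ++-assoc U _ _ ⟩
    U ++ (zeros k ++ X) ∷ʳ true ∷ D ++ [ (Y ++ zeros k) ∷ʳ false ] ∎)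
    where open ≡-Reasoning

countTrace : Word → ℕ → List Word
countTrace u zero    = []
countTrace u (suc k) = countTrace (u ∷ʳ false) k ++ incrementTrace u k ++ countTrace (u ∷ʳ true) k

turnDown-up : ∀ b v → turn b p s ≡ st up p s′ →
              step (conf down p s (true ∷ b ∷ v)) ≡ just (conf up p s′ (true ∷ b ∷ v))
turnDown-up {p = p} {s = s} b v h =
  trans (step-turnDown p s b v) (cong (λ q → just (q , (true ∷ b ∷ v) ∷ʳ bit p)) h)

count : ∀ k b v → turn b p s ≡ st up p s →
        Run (conf up p s (true ∷ b ∷ v ++ zeros k)) (countTrace (b ∷ v) k)
            (conf up p s (true ∷ b ∷ v ++ ones k))
count zero    b v h = stop
count {p = p} {s = s} (suc k) b v h =
  cast (grow false (zeros k)) refl (grow true (ones k))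
    (count k b (v ∷ʳ false) h ◅◅
     increment (b ∷ v) k (turnDown-up b (v ∷ʳ true ++ zeros k) h) ◅◅
     count k b (v ∷ʳ true) h)
  where
  grow : ∀ a rest → conf up p s (true ∷ b ∷ v ∷ʳ a ++ rest) ≡ conf up p s (true ∷ b ∷ v ++ a ∷ rest)
  grow a rest = cong (λ w → conf up p s (true ∷ b ∷ w)) (∷ʳ-++ v a rest)

overflowTrace : ℕ → List Word
overflowTrace n = map (_∷ʳ true) (upShifts [] (suc (suc n)) ∷ʳ zeros (suc (suc n)))
               ++ map (_∷ʳ false) (downShifts (true ∷ []) (suc n))

overflow : ∀ n → Run (conf up p s (ones (suc (suc n)))) (overflowTrace n)
                     (conf down (flipP p) s (true ∷ zeros (suc n)))
overflow {p = p} {s = s} n =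
  cast refl trace-≡ refl
    (cast refl refl (cong (conf up q s) (++-identityʳ (zeros (suc (suc n))))) (shiftUp (suc (suc n)) []) ◅◅
     moveVia (zeros (suc (suc n))) (replicate-suc (suc n) false) (step-turnUp q s (zeros (suc n))) refl
       (cast refl refl (cong (λ p′ → conf down p′ s (true ∷ zeros (suc n)))
                             (flipN-involutive (suc n) (flipP p)))
             (shiftDown (suc n) (true ∷ []))))
  where
  q : Par
  q = flipN (suc (suc n)) p
  U D : List Word
  U = map (_∷ʳ true) (upShifts [] (suc (suc n)))
  D = map (_∷ʳ false) (downShifts (true ∷ []) (suc n))
  trace-≡ : U ++ zeros (suc (suc n)) ∷ʳ true ∷ D ≡ overflowTrace n
  trace-≡ = sym (trans (cong (_++ D) (map-++ _ (upShifts [] (suc (suc n))) _)) (++-assoc U _ D))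

phaseBody : ℕ → Word
phaseBody n = true ∷ false ∷ zeros n

phaseTrace : ℕ → List Word
phaseTrace n = countTrace [] (suc n) ++ overflowTrace n

phase : ∀ n {p sa sb} →
        turn false p sa ≡ st up p sa → turn true p sb ≡ st up p sb → turn true p sa ≡ st up p sb →
        Run (conf up p sa (phaseBody n)) (phaseTrace n) (conf down (flipP p) sb (phaseBody n))
phase n ha hb hab =
  (count n false [] ha ◅◅ increment [] n (turnDown-up true (zeros n) hab) ◅◅ count n true [] hb) ◅◅ overflow n

evenPhase : ∀ n → Run (conf up even s1 (phaseBody n)) (phaseTrace n) (conf down odd s2 (phaseBody n))
evenPhase n = phase n refl refl refl

oddPhase : ∀ n → Run (conf up odd s3 (phaseBody n)) (phaseTrace n) (conf down even s4 (phaseBody n))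
oddPhase n = phase n refl refl refl

halting : ∀ n → Run (conf down even s4 (phaseBody n)) [ phaseBody n ∷ʳ false ] (qh , phaseBody n ∷ʳ false)
halting n = move (phaseBody n) (step-turnDown even s4 false (zeros n)) stop

switching : ∀ n → Run (conf down odd s2 (phaseBody n))
                      (phaseBody n ∷ʳ false ∷ phaseTrace n ++ [ phaseBody n ∷ʳ false ])
                      (qh , phaseBody n ∷ʳ false)
switching n = move (phaseBody n) (step-turnDown odd s2 false (zeros n)) (oddPhase n ◅◅ halting n)

fullTrace : ℕ → List Word
fullTrace n = zeros (3 + n) ∷ phaseTrace n ++ phaseBody n ∷ʳ false ∷ phaseTrace n ++ [ phaseBody n ∷ʳ false ]

fullRun : ∀ n → Run (qi , zeros (3 + n)) (fullTrace n) (qh , phaseBody n ∷ʳ false)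
fullRun n = next initial start (evenPhase n ◅◅ switching n)
  where
  start : step (qi , zeros (3 + n)) ≡ just (conf up even s1 (phaseBody n))
  start = subst (λ w → step (qi , false ∷ false ∷ w) ≡ just (conf up even s1 (phaseBody n)))
                (sym (replicate-suc n false)) (step-init (false ∷ zeros n))

-- Enumerating the words

allWords : ℕ → List Word
allWords zero    = [ [] ]
allWords (suc m) = map (false ∷_) (allWords m) ++ map (true ∷_) (allWords m)

extensions : List Word → List Word
extensions ws = map (_∷ʳ true) ws ++ map (_∷ʳ false) ws

extensions⁺ : ∀ {ws vs} → ws ↭ vs → extensions ws ↭ extensions vs
extensions⁺ ws↭vs = ++⁺ (map⁺ _ ws↭vs) (map⁺ _ ws↭vs)

extensions-++ : ∀ ws vs → extensions (ws ++ vs) ↭ extensions ws ++ extensions vs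
extensions-++ ws vs = begin
  map (_∷ʳ true) (ws ++ vs) ++ map (_∷ʳ false) (ws ++ vs)
    ≡⟨ cong₂ _++_ (map-++ _ ws vs) (map-++ _ ws vs) ⟩
  (W₁ ++ V₁) ++ (W₀ ++ V₀)
    ↭⟨ solve 4 (λ a b c d → (a ⊕ b) ⊕ (c ⊕ d) ⊜ (a ⊕ c) ⊕ (b ⊕ d)) ↭-refl W₁ V₁ W₀ V₀ ⟩
  (W₁ ++ W₀) ++ (V₁ ++ V₀) ∎
  where
  open PermutationReasoning
  W₁ V₁ W₀ V₀ : List Word
  W₁ = map (_∷ʳ true) ws
  V₁ = map (_∷ʳ true) vs
  W₀ = map (_∷ʳ false) ws
  V₀ = map (_∷ʳ false) vs

map-∷-∷ʳ : ∀ (a b : Bool) (ws : List Word) → map (a ∷_) (map (_∷ʳ b) ws) ≡ map (_∷ʳ b) (map (a ∷_) ws)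
map-∷-∷ʳ a b ws = trans (sym (map-∘ {g = a ∷_} {f = _∷ʳ b} ws)) (map-∘ {g = _∷ʳ b} {f = a ∷_} ws)

allWords-extensions : ∀ m → allWords (suc m) ↭ extensions (allWords m)
allWords-extensions zero    = ++-comm [ [ false ] ] [ [ true ] ]
allWords-extensions (suc m) = begin
  map (false ∷_) (allWords (suc m)) ++ map (true ∷_) (allWords (suc m))
    ↭⟨ ++⁺ (map⁺ _ (allWords-extensions m)) (map⁺ _ (allWords-extensions m)) ⟩
  map (false ∷_) (ext-m) ++ map (true ∷_) (ext-m)
    ≡⟨ cong₂ _++_ (map-++ _ (map (_∷ʳ true) ws) _) (map-++ _ (map (_∷ʳ true) ws) _) ⟩
  (map (false ∷_) (map (_∷ʳ true) ws) ++ map (false ∷_) (map (_∷ʳ false) ws))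
    ++ (map (true ∷_) (map (_∷ʳ true) ws) ++ map (true ∷_) (map (_∷ʳ false) ws))
    ≡⟨ cong₂ _++_ (cong₂ _++_ (map-∷-∷ʳ false true ws) (map-∷-∷ʳ false false ws))
                  (cong₂ _++_ (map-∷-∷ʳ true true ws) (map-∷-∷ʳ true false ws)) ⟩
  (A₁ ++ A₀) ++ (B₁ ++ B₀)
    ↭⟨ solve 4 (λ a b c d → (a ⊕ b) ⊕ (c ⊕ d) ⊜ (a ⊕ c) ⊕ (b ⊕ d)) ↭-refl A₁ A₀ B₁ B₀ ⟩
  (A₁ ++ B₁) ++ (A₀ ++ B₀)
    ≡⟨ sym (cong₂ _++_ (map-++ _ (map (false ∷_) ws) _) (map-++ _ (map (false ∷_) ws) _)) ⟩
  extensions (allWords (suc m)) ∎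
  where
  open PermutationReasoning
  ws ext-m A₁ A₀ B₁ B₀ : List Word
  ws = allWords m
  ext-m = extensions ws
  A₁ = map (_∷ʳ true) (map (false ∷_) ws)
  A₀ = map (_∷ʳ false) (map (false ∷_) ws)
  B₁ = map (_∷ʳ true) (map (true ∷_) ws)
  B₀ = map (_∷ʳ false) (map (true ∷_) ws)

-- The words 0ⁱ 1 u y with i + |y| = k: those of length |u| + k + 1 in which u follows the first 1.
afterFirstOne : Word → ℕ → List Word
afterFirstOne u zero    = [ true ∷ u ]
afterFirstOne u (suc k) = map ((true ∷ u) ++_) (allWords (suc k)) ++ map (false ∷_) (afterFirstOne u k)

map-++-∷ : ∀ (P : Word) b (ws : List Word) → map (P ++_) (map (b ∷_) ws) ≡ map ((P ∷ʳ b) ++_) ws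
map-++-∷ P b ws = trans (sym (map-∘ {g = P ++_} {f = b ∷_} ws)) (map-cong (λ y → sym (∷ʳ-++ P b y)) ws)

afterFirstOne-split : ∀ u k → afterFirstOne u (suc k) ↭
  afterFirstOne (u ∷ʳ false) k ++ afterFirstOne (u ∷ʳ true) k ++ [ zeros (suc k) ++ true ∷ u ]
afterFirstOne-split u zero    = ↭-refl
afterFirstOne-split u (suc k) = begin
  map ((true ∷ u) ++_) (allWords (suc (suc k))) ++ map (false ∷_) (afterFirstOne u (suc k))
    ≡⟨ cong (_++ map (false ∷_) (afterFirstOne u (suc k))) (trans (map-++ _ (map (false ∷_) ws) _)
                           (cong₂ _++_ (map-++-∷ (true ∷ u) false ws) (map-++-∷ (true ∷ u) true ws))) ⟩
  (P₀ ++ P₁) ++ map (false ∷_) (afterFirstOne u (suc k))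
    ↭⟨ ++⁺ˡ (P₀ ++ P₁) (map⁺ _ (afterFirstOne-split u k)) ⟩
  (P₀ ++ P₁) ++ map (false ∷_) (F₀ ++ F₁ ++ [ a ])
    ≡⟨ cong ((P₀ ++ P₁) ++_) (trans (map-++ _ F₀ _) (cong (map (false ∷_) F₀ ++_) (map-++ _ F₁ _))) ⟩
  (P₀ ++ P₁) ++ (map (false ∷_) F₀ ++ map (false ∷_) F₁ ++ [ false ∷ a ])
    ↭⟨ solve 5 (λ p₀ p₁ f₀ f₁ z → (p₀ ⊕ p₁) ⊕ (f₀ ⊕ f₁ ⊕ z) ⊜ (p₀ ⊕ f₀) ⊕ (p₁ ⊕ f₁) ⊕ z)
               ↭-refl P₀ P₁ (map (false ∷_) F₀) (map (false ∷_) F₁) [ false ∷ a ] ⟩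
  afterFirstOne (u ∷ʳ false) (suc k) ++ afterFirstOne (u ∷ʳ true) (suc k)
    ++ [ zeros (suc (suc k)) ++ true ∷ u ] ∎
  where
  open PermutationReasoning
  ws P₀ P₁ F₀ F₁ : List Word
  ws = allWords (suc k)
  P₀ = map ((true ∷ u ∷ʳ false) ++_) ws
  P₁ = map ((true ∷ u ∷ʳ true) ++_) ws
  F₀ = afterFirstOne (u ∷ʳ false) k
  F₁ = afterFirstOne (u ∷ʳ true) k
  a : Word
  a = zeros (suc k) ++ true ∷ u

afterFirstOne-[] : ∀ k → afterFirstOne [] k ++ [ zeros (suc k) ] ↭ allWords (suc k)
afterFirstOne-[] zero    = ++-comm [ [ true ] ] [ [ false ] ]
afterFirstOne-[] (suc k) = begin
  (map (true ∷_) ws ++ map (false ∷_) (afterFirstOne [] k)) ++ [ zeros (suc (suc k)) ]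
    ≡⟨ ++-assoc (map (true ∷_) ws) _ _ ⟩
  map (true ∷_) ws ++ map (false ∷_) (afterFirstOne [] k) ++ map (false ∷_) [ zeros (suc k) ]
    ≡⟨ cong (map (true ∷_) ws ++_) (sym (map-++ _ (afterFirstOne [] k) _)) ⟩
  map (true ∷_) ws ++ map (false ∷_) (afterFirstOne [] k ++ [ zeros (suc k) ])
    ↭⟨ ++⁺ˡ (map (true ∷_) ws) (map⁺ _ (afterFirstOne-[] k)) ⟩
  map (true ∷_) ws ++ map (false ∷_) ws
    ↭⟨ ++-comm (map (true ∷_) ws) _ ⟩
  allWords (suc (suc k)) ∎
  where
  open PermutationReasoning
  ws : List Word
  ws = allWords (suc k)

upShifts-suc : ∀ X j → upShifts X (suc j) ≡ upSweep (X ∷ʳ true) j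
upShifts-suc X zero    = refl
upShifts-suc X (suc j) = trans (cong ((X ++ ones (suc (suc j))) ∷_) (upShifts-suc (false ∷ X) j))
  (cong₂ (λ h z → h ∷ upShifts (false ∷ X ∷ʳ true) j ∷ʳ z)
         (sym (∷ʳ-++ X true (ones (suc j)))) (replicate-∷-comm j false (X ∷ʳ true)))

downSweep-suc : ∀ Y j → downSweep Y (suc j) ≡ (zeros (suc j) ++ Y) ∷ downSweep (Y ∷ʳ false) j
downSweep-suc Y j =
  cong (λ z → (zeros (suc j) ++ Y) ∷ downShifts (Y ∷ʳ false) j ∷ʳ z) (sym (∷ʳ-++ Y false (zeros j)))

sweeps : Word → ℕ → List Word
sweeps u k = map (_∷ʳ true) (upSweep (true ∷ u) k) ++ map (_∷ʳ false) (downSweep (true ∷ u) k)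

-- sweeps u k are the rotations visited by an overflow of the counter 1u1ᵏ.  For a count with
-- k + 1 free letters, its middle increment and these sweeps regroup into the sweeps of its two
-- halves and the two extensions of 0ᵏ⁺¹1u.
countTrace-complete : ∀ u k → countTrace u k ++ sweeps u k ↭ extensions (afterFirstOne u k)
countTrace-complete u zero    =
  ↭-reflexive (cong (λ w → [ (true ∷ u) ∷ʳ true ] ++ [ w ∷ʳ false ]) (++-identityʳ (true ∷ u)))
countTrace-complete u (suc k) = begin
  (C₀ ++ (U₀ ++ D₁) ++ C₁) ++ map (_∷ʳ true) (upSweep (true ∷ u) (suc k))
                           ++ map (_∷ʳ false) (downSweep (true ∷ u) (suc k))
    ≡⟨ cong₂ (λ us ds → (C₀ ++ (U₀ ++ D₁) ++ C₁) ++ map (_∷ʳ true) us ++ map (_∷ʳ false) ds)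
             (cong (_∷ʳ (zeros (suc k) ++ true ∷ u)) (upShifts-suc (true ∷ u) k)) (downSweep-suc (true ∷ u) k) ⟩
  (C₀ ++ (U₀ ++ D₁) ++ C₁) ++ map (_∷ʳ true) (upSweep (true ∷ u ∷ʳ true) k ∷ʳ a) ++ a ∷ʳ false ∷ D₀
    ≡⟨ cong (λ us → (C₀ ++ (U₀ ++ D₁) ++ C₁) ++ us ++ a ∷ʳ false ∷ D₀)
            (map-++ _ (upSweep (true ∷ u ∷ʳ true) k) _) ⟩
  (C₀ ++ (U₀ ++ D₁) ++ C₁) ++ (U₁ ++ [ a ∷ʳ true ]) ++ [ a ∷ʳ false ] ++ D₀
    ↭⟨ solve 8 (λ c₀ u₀ d₁ c₁ u₁ a₁ a₀ d₀ → (c₀ ⊕ (u₀ ⊕ d₁) ⊕ c₁) ⊕ (u₁ ⊕ a₁) ⊕ a₀ ⊕ d₀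
                                          ⊜ (c₀ ⊕ u₀ ⊕ d₀) ⊕ (c₁ ⊕ u₁ ⊕ d₁) ⊕ (a₁ ⊕ a₀))
             ↭-refl C₀ U₀ D₁ C₁ U₁ [ a ∷ʳ true ] [ a ∷ʳ false ] D₀ ⟩
  (C₀ ++ sweeps (u ∷ʳ false) k) ++ (C₁ ++ sweeps (u ∷ʳ true) k) ++ extensions [ a ]
    ↭⟨ ++⁺ (countTrace-complete (u ∷ʳ false) k)
           (++⁺ʳ (extensions [ a ]) (countTrace-complete (u ∷ʳ true) k)) ⟩
  extensions F₀ ++ extensions F₁ ++ extensions [ a ]
    ↭⟨ ↭-sym (↭-trans (extensions-++ F₀ _) (++⁺ˡ (extensions F₀) (extensions-++ F₁ [ a ]))) ⟩
  extensions (F₀ ++ F₁ ++ [ a ])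
    ↭⟨ extensions⁺ (↭-sym (afterFirstOne-split u k)) ⟩
  extensions (afterFirstOne u (suc k)) ∎
  where
  open PermutationReasoning
  a : Word
  a = zeros (suc k) ++ true ∷ u
  C₀ C₁ U₀ U₁ D₀ D₁ F₀ F₁ : List Word
  C₀ = countTrace (u ∷ʳ false) k
  C₁ = countTrace (u ∷ʳ true) k
  U₀ = map (_∷ʳ true) (upSweep (true ∷ u ∷ʳ false) k)
  U₁ = map (_∷ʳ true) (upSweep (true ∷ u ∷ʳ true) k)
  D₀ = map (_∷ʳ false) (downSweep (true ∷ u ∷ʳ false) k)
  D₁ = map (_∷ʳ false) (downSweep (true ∷ u ∷ʳ true) k)
  F₀ = afterFirstOne (u ∷ʳ false) k
  F₁ = afterFirstOne (u ∷ʳ true) k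

phaseTrace-complete : ∀ n → phaseTrace n ++ [ phaseBody n ∷ʳ false ]
                            ↭ extensions (afterFirstOne [] (suc n)) ++ [ zeros (suc (suc n)) ∷ʳ true ]
phaseTrace-complete n = begin
  (C ++ map (_∷ʳ true) (upShifts [] (suc (suc n)) ∷ʳ z) ++ D) ++ [ f ]
    ≡⟨ cong (λ us → (C ++ map (_∷ʳ true) (us ∷ʳ z) ++ D) ++ [ f ]) (upShifts-suc [] (suc n)) ⟩
  (C ++ map (_∷ʳ true) (upSweep (true ∷ []) (suc n) ∷ʳ z) ++ D) ++ [ f ]
    ≡⟨ cong (λ us → (C ++ us ++ D) ++ [ f ]) (map-++ _ (upSweep (true ∷ []) (suc n)) [ z ]) ⟩
  (C ++ (U ++ [ z ∷ʳ true ]) ++ D) ++ [ f ]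
    ↭⟨ solve 5 (λ c u z₁ d f₀ → (c ⊕ (u ⊕ z₁) ⊕ d) ⊕ f₀ ⊜ (c ⊕ u ⊕ (d ⊕ f₀)) ⊕ z₁)
               ↭-refl C U [ z ∷ʳ true ] D [ f ] ⟩
  (C ++ U ++ D ++ [ f ]) ++ [ z ∷ʳ true ]
    ≡⟨ cong (λ ds → (C ++ U ++ ds) ++ [ z ∷ʳ true ]) (sym (map-++ _ (downShifts (true ∷ []) (suc n)) _)) ⟩
  (C ++ sweeps [] (suc n)) ++ [ z ∷ʳ true ]
    ↭⟨ ++⁺ʳ _ (countTrace-complete [] (suc n)) ⟩
  extensions (afterFirstOne [] (suc n)) ++ [ z ∷ʳ true ] ∎
  where
  open PermutationReasoning
  z f : Word
  z = zeros (suc (suc n))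
  f = phaseBody n ∷ʳ false
  C U D : List Word
  C = countTrace [] (suc n)
  U = map (_∷ʳ true) (upSweep (true ∷ []) (suc n))
  D = map (_∷ʳ false) (downShifts (true ∷ []) (suc n))

phaseTrace-allWords : ∀ n → zeros (3 + n) ∷ phaseTrace n ++ [ phaseBody n ∷ʳ false ] ↭ allWords (3 + n)
phaseTrace-allWords n = begin
  zeros (3 + n) ∷ phaseTrace n ++ [ phaseBody n ∷ʳ false ]
    ↭⟨ prep _ (phaseTrace-complete n) ⟩
  zeros (3 + n) ∷ E ++ [ z ∷ʳ true ]
    ≡⟨ cong (λ w → w ∷ E ++ [ z ∷ʳ true ]) (replicate-suc (suc (suc n)) false) ⟩
  [ z ∷ʳ false ] ++ E ++ [ z ∷ʳ true ]
    ↭⟨ solve 3 (λ z₀ e z₁ → z₀ ⊕ (e ⊕ z₁) ⊜ e ⊕ (z₁ ⊕ z₀)) ↭-refl [ z ∷ʳ false ] E [ z ∷ʳ true ] ⟩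
  E ++ extensions [ z ]
    ↭⟨ ↭-sym (extensions-++ (afterFirstOne [] (suc n)) [ z ]) ⟩
  extensions (afterFirstOne [] (suc n) ++ [ z ])
    ↭⟨ extensions⁺ (afterFirstOne-[] (suc n)) ⟩
  extensions (allWords (2 + n))
    ↭⟨ ↭-sym (allWords-extensions (2 + n)) ⟩
  allWords (3 + n) ∎
  where
  open PermutationReasoning
  z : Word
  z = zeros (suc (suc n))
  E : List Word
  E = extensions (afterFirstOne [] (suc n))

fullTrace-everyOther : ∀ n → everyOther true (fullTrace n)
  ≡ zeros (3 + n) ∷ everyOther false (phaseTrace n) ++ everyOther true (phaseTrace n) ++ [ phaseBody n ∷ʳ false ]
fullTrace-everyOther n = cong (zeros (3 + n) ∷_)
  (trans (everyOther-◅◅ (evenPhase n) (switching n))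
         (cong (everyOther false (phaseTrace n) ++_) (everyOther-◅◅ (oddPhase n) (halting n))))

fullTrace-outputs : ∀ n → everyOther true (fullTrace n) ↭ allWords (3 + n)
fullTrace-outputs n = begin
  everyOther true (fullTrace n)
    ≡⟨ fullTrace-everyOther n ⟩
  zeros (3 + n) ∷ everyOther false P ++ everyOther true P ++ [ f ]
    ≡⟨ cong (zeros (3 + n) ∷_) (sym (++-assoc (everyOther false P) _ _)) ⟩
  zeros (3 + n) ∷ (everyOther false P ++ everyOther true P) ++ [ f ]
    ↭⟨ prep _ (++⁺ʳ [ f ] (everyOther-complement false P)) ⟩
  zeros (3 + n) ∷ P ++ [ f ]
    ↭⟨ phaseTrace-allWords n ⟩
  allWords (3 + n) ∎
  where
  open PermutationReasoning
  P : List Word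
  P = phaseTrace n
  f : Word
  f = phaseBody n ∷ʳ false

allWords-length : ∀ m → All (λ v → length v ≡ m) (allWords m)
allWords-length zero    = refl ∷ []
allWords-length (suc m) = All.++⁺ (grow false) (grow true)
  where
  grow : ∀ b → All (λ v → length v ≡ suc m) (map (b ∷_) (allWords m))
  grow b = All.map⁺ (All.map (cong suc) (allWords-length m))

occurrences-++ : ∀ u ws vs → occurrences u (ws ++ vs) ≡ occurrences u ws + occurrences u vs
occurrences-++ u ws vs = trans (cong length (filter-++ (≡-dec Bool._≟_ u) ws vs)) (length-++ (filter _ ws))

occurrences-∷ : ∀ b u ws → occurrences (b ∷ u) (map (b ∷_) ws) ≡ occurrences u ws
occurrences-∷ b u []       = refl
occurrences-∷ b u (w ∷ ws) = by-head (≡-dec Bool._≟_ u w)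
  where
  by-head : Dec (u ≡ w) → occurrences (b ∷ u) (map (b ∷_) (w ∷ ws)) ≡ occurrences u (w ∷ ws)
  by-head (yes refl) = trans (cong length (filter-accept (≡-dec Bool._≟_ (b ∷ u)) refl))
    (trans (cong suc (occurrences-∷ b u ws)) (sym (cong length (filter-accept (≡-dec Bool._≟_ u) refl))))
  by-head (no u≢w)   = trans (cong length (filter-reject (≡-dec Bool._≟_ (b ∷ u)) (u≢w ∘′ ∷-injectiveʳ)))
    (trans (occurrences-∷ b u ws) (sym (cong length (filter-reject (≡-dec Bool._≟_ u) u≢w))))

occurrences-∷-≢ : ∀ {b b′} u ws → b ≢ b′ → occurrences (b ∷ u) (map (b′ ∷_) ws) ≡ 0
occurrences-∷-≢ u []       b≢b′ = refl
occurrences-∷-≢ u (w ∷ ws) b≢b′ =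
  trans (cong length (filter-reject (≡-dec Bool._≟_ (_ ∷ u)) (b≢b′ ∘′ ∷-injectiveˡ)))
        (occurrences-∷-≢ u ws b≢b′)

occurrences-allWords : ∀ u → occurrences u (allWords (length u)) ≡ 1
occurrences-allWords []          = refl
occurrences-allWords (false ∷ u) =
  trans (occurrences-++ (false ∷ u) (map (false ∷_) ws) _)
        (cong₂ _+_ (trans (occurrences-∷ false u ws) (occurrences-allWords u)) (occurrences-∷-≢ u ws λ ()))
  where ws : List Word
        ws = allWords (length u)
occurrences-allWords (true ∷ u)  =
  trans (occurrences-++ (true ∷ u) (map (false ∷_) ws) _)
        (cong₂ _+_ (occurrences-∷-≢ u ws λ ()) (trans (occurrences-∷ true u ws) (occurrences-allWords u)))
  where ws : List Word
        ws = allWords (length u)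

enumerates-allWords : ∀ {ws} m → ws ↭ allWords m →
  All (λ v → length v ≡ m) ws × ((u : Word) → length u ≡ m → occurrences u ws ≡ 1)
enumerates-allWords m ws↭ =
  All-resp-↭ (↭-sym ws↭) (allWords-length m) ,
  λ { u refl → trans (↭-length (filter-↭ (≡-dec Bool._≟_ u) ws↭)) (occurrences-allWords u) }

proposition10 : ∃[ B ] ((ℓ : ℕ) → 3 ≤ ℓ →
    ∃[ n ] ((∃[ w ] (run ℓ n ≡ just (qh , w)))
      × All (λ v → length v ≡ ℓ) (map proj₂ (outputs ℓ n))
      × ((u : Word) → length u ≡ ℓ → occurrences u (map proj₂ (outputs ℓ n)) ≡ 1)
      × Delay B 0 (map proj₁ (outputs ℓ n)) n))
proposition10 = 2 , λ where
  .(3 + n) (s≤s (s≤s (s≤s (z≤n {n})))) →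
    let tr = fullTrace n
        halts , outputs≡ = Run-sound {ℓ = 3 + n} {t = 0} refl (fullRun n)
        words = ↭-trans (↭-reflexive (trans (cong (map proj₂) outputs≡) (map-proj₂-everyOther-timed true 0 tr)))
                        (fullTrace-outputs n)
        lengths , once = enumerates-allWords (3 + n) words
    in length tr , (_ , halts) , lengths , once ,
       subst (λ ts → Delay 2 0 ts (length tr)) (cong (map proj₁) (sym outputs≡))
             (everyOther-delay true 0 0 tr z≤n)
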